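{- Let $n\ge 2$ and $c\ge 1$ be integers. The disjoint union $cK_n$ of $c$ copies of the complete graph $K_n$ is closed distance magic if and only if $n(c+1)\equiv 0\pmod 2$.
   Context: A graph on $N$ vertices is closed distance magic if there is a bijection $\ell\colon V\to\{1,\dots,N\}$ and a positive integer $k'$ such that the sum of $\ell$ over the closed neighborhood $N[x]$ ($x$ and its neighbors) of every vertex $x$ equals $k'$. -}

module Defs where

open import Data.Nat using (ℕ; zero; suc; _+_; _*_)
open import Data.Fin using (Fin; toℕ; quotient)
open import Data.Fin.Properties using () renaming (_≟_ to _≟ᶠ_)
open import Data.List using (List; map; filter; _++_)
open import Data.Nat.ListAction using (sum)
open import Data.List.Base using (allFin)
open import Data.Product using (Σ; _×_; _,_)
open import Data.Sum using (_⊎_)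
open import Function.Bundles using (Bijection)
open import Relation.Binary.PropositionalEquality using (_≡_; _≢_)
open import Relation.Nullary using (¬_; Dec; yes; no)
open import Relation.Nullary.Decidable using (_×-dec_; ¬?)
open import Level using (0ℓ)

record Graph (N : ℕ) : Set₁ where
  field
    Adj      : Fin N → Fin N → Set
    adj?     : ∀ x y → Dec (Adj x y)
    sym      : ∀ {x y} → Adj x y → Adj y x
    irrefl   : ∀ {x} → ¬ Adj x x

open Graph public

closedNbhd : ∀ {N} → Graph N → Fin N → List (Fin N)
closedNbhd {N} G x = filter (λ y → (y ≟ᶠ x)) (allFin N)
                     ++ filter (λ y → adj? G x y) (allFin N)

-- Closed distance magic: a bijection ℓ : V → {1,…,N} (encoded as Fin N,
-- value toℕ i + 1) and a positive integer k' such that for every vertex x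
-- the sum of ℓ over N[x] equals k'.
labelSum : ∀ {N} → Graph N → (Fin N → Fin N) → Fin N → ℕ
labelSum G ℓ x = sum (map (λ y → suc (toℕ (ℓ y))) (closedNbhd G x))

ClosedDistanceMagic : ∀ {N} → Graph N → Set
ClosedDistanceMagic {N} G =
  Σ (Bijection (Data.Fin.Properties.≡-setoid N) (Data.Fin.Properties.≡-setoid N)) λ b →
  Σ ℕ λ k' → (0 Data.Nat.< k') ×
    (∀ x → labelSum G (Bijection.to b) x ≡ k')

-- The disjoint union c K_n on Fin (c * n): vertex i lies in copy
-- quotient n i; two vertices are adjacent iff they are distinct and lie in
-- the same copy.
cK : (c n : ℕ) → Graph (c * n)
cK c n = record
  { Adj    = λ x y → (quotient {c} n x ≡ quotient {c} n y) × (x ≢ y)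
  ; adj?   = λ x y → (quotient {c} n x ≟ᶠ quotient {c} n y) ×-dec ¬? (x ≟ᶠ y)
  ; sym    = λ { (p , q) → Relation.Binary.PropositionalEquality.sym p
                         , (λ e → q (Relation.Binary.PropositionalEquality.sym e)) }
  ; irrefl = λ { (_ , q) → q Relation.Binary.PropositionalEquality.refl }
  }

-- In c K_n the closed neighbourhood of a vertex is its whole copy of K_n, so a labelling is
-- closed distance magic exactly when all c copies carry the same label sum k′. Summing over
-- the copies gives c k′ = cn(cn+1)/2, i.e. 2k′ = n(cn+1), which forces n(c+1) to be even.
-- Conversely, let σ₀,…,σₙ₋₁ be the rows of an n × c Kotzig array: permutations of
-- {0,…,c−1} whose column sums Σₖ σₖ(q) are all equal. Labelling vertex k of copy q by
-- n σₖ(q) + k + 1 is then a bijection with equal copy sums. Kotzig arrays are built by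
-- stacking: the two rows (identity, reversal) work for every c, and for odd c = 2s+1 the
-- three rows identity, q ↦ q + s and q ↦ 2(s − q) (both mod c) have column sum 3s. So an
-- array exists when n is even, and when n ≥ 3 and c are both odd.
module Submission where

open import Defs hiding (sym)
open import Data.Fin
  using (Fin; zero; suc; toℕ; fromℕ<; inject₁; punchOut; splitAt; _↑ˡ_; _↑ʳ_;
         combine; quotient; remQuot)
import Data.Fin.Properties as Fin
open import Data.Fin.Properties
  using (toℕ<n; toℕ-fromℕ; toℕ-fromℕ<; toℕ-inject₁; toℕ-injective; toℕ-combine;
         combine-injective; combine-remQuot; remQuot-combine; any?; injective⇒≤; punchOut-injective)
  renaming (_≟_ to _≟ᶠ_)
open import Data.List using (List; []; _∷_; _++_; map; filter; tabulate; allFin)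
open import Data.List.Properties using (map-++; map-tabulate)
open import Data.Nat using (ℕ; zero; suc; pred; _+_; _*_; _∸_; _≤_; _<_; _%_; z≤n; s≤s; s≤s⁻¹; NonZero)
open import Data.Nat.DivMod using (m*n%n≡0; [m+kn]%n≡m%n)
import Data.Nat.ListAction as List
open import Data.Nat.ListAction.Properties using (sum-++)
open import Data.Nat.Properties
  using (suc-injective; +-assoc; +-comm; +-suc; +-identityʳ; *-assoc; *-comm; *-suc; *-distribˡ-+;
         +-cancelʳ-≡; *-cancelˡ-≡; ∸-cancelˡ-≡; m+n∸m≡n; m+[n∸m]≡n; even≢odd;
         _≤?_; ≤-reflexive; ≤-trans; ≰⇒>; 1+n≰n; m≤m+n; m≤n+m; m+n≤o⇒m≤o; +-cancelˡ-≤;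
         +-*-semiring; module ≤-Reasoning)
open import Algebra.Properties.Semiring.Sum +-*-semiring
  using (sum; sum-syntax; sum-cong-≗; sum-init-last; ∑-distrib-+; ∑-permute; *-distribˡ-sum)
open import Data.Nat.Tactic.RingSolver using (solve-∀; solve)
open import Data.Product using (_×_; _,_; proj₁; proj₂; uncurry)
open import Data.Sum using (inj₁; inj₂)
open import Data.Vec.Functional using () renaming (_++_ to _++ᵛ_)
open import Data.Vec.Functional.Properties using (lookup-++ˡ; lookup-++ʳ)
open import Function using (_∘_; id)
open import Function.Bundles using (Bijection; _⤖_; mk⤖; _⇔_; mk⇔)
open import Function.Consequences.Propositional using (strictlySurjective⇒surjective)
open import Function.Definitions using (Injective; StrictlySurjective)
open import Function.Properties.Bijection using (Bijection⇒Inverse)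
open import Level using (0ℓ)
open import Relation.Binary.PropositionalEquality
open import Relation.Nullary using (¬_; yes; no)
open import Relation.Nullary.Negation using (contradiction)
open import Relation.Unary using (Pred; Decidable)

-- Finite sums

∑-const : ∀ n a → ∑[ i < n ] a ≡ n * a
∑-const zero    a = refl
∑-const (suc n) a = cong (a +_) (∑-const n a)

∑-zero : ∀ {n} (f : Fin n → ℕ) → (∀ i → f i ≡ 0) → sum f ≡ 0
∑-zero {zero}  f zeros = refl
∑-zero {suc n} f zeros = cong₂ _+_ (zeros zero) (∑-zero (f ∘ suc) (zeros ∘ suc))

∑-single : ∀ {n} (f : Fin n → ℕ) q → (∀ q′ → q′ ≢ q → f q′ ≡ 0) → sum f ≡ f q
∑-single f zero    off =
  trans (cong (f zero +_) (∑-zero (f ∘ suc) (λ i → off (suc i) λ ()))) (+-comm (f zero) 0)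
∑-single f (suc q) off =
  trans (cong (_+ sum (f ∘ suc)) (off zero λ ()))
        (∑-single (f ∘ suc) q (λ q′ q′≢q → off (suc q′) (q′≢q ∘ Fin.suc-injective)))

∑-↑ˡ-↑ʳ : ∀ m n (f : Fin (m + n) → ℕ) →
          sum f ≡ ∑[ i < m ] f (i ↑ˡ n) + ∑[ j < n ] f (m ↑ʳ j)
∑-↑ˡ-↑ʳ zero    n f = refl
∑-↑ˡ-↑ʳ (suc m) n f = trans (cong (f zero +_) (∑-↑ˡ-↑ʳ m n (f ∘ suc))) (sym (+-assoc (f zero) _ _))

∑-combine : ∀ c n (f : Fin (c * n) → ℕ) → sum f ≡ ∑[ q < c ] ∑[ k < n ] f (combine q k)
∑-combine zero    n f = refl
∑-combine (suc c) n f =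
  trans (∑-↑ˡ-↑ʳ n (c * n) f) (cong (∑[ k < n ] f (k ↑ˡ c * n) +_) (∑-combine c n (f ∘ (n ↑ʳ_))))

double-∑-suc-toℕ : ∀ n → 2 * ∑[ i < n ] suc (toℕ i) ≡ n * suc n
double-∑-suc-toℕ zero    = refl
double-∑-suc-toℕ (suc n) = begin
  2 * ∑[ i < suc n ] suc (toℕ i)         ≡⟨ cong (2 *_) split-last ⟩
  2 * (∑[ i < n ] suc (toℕ i) + suc n)   ≡⟨ *-distribˡ-+ 2 (∑[ i < n ] suc (toℕ i)) (suc n) ⟩
  2 * ∑[ i < n ] suc (toℕ i) + 2 * suc n ≡⟨ cong (_+ 2 * suc n) (double-∑-suc-toℕ n) ⟩
  n * suc n + 2 * suc n                  ≡⟨ solve (n ∷ []) ⟩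
  suc n * suc (suc n)                    ∎
  where
  open ≡-Reasoning
  split-last : ∑[ i < suc n ] suc (toℕ i) ≡ ∑[ i < n ] suc (toℕ i) + suc n
  split-last = trans (sum-init-last {n} (suc ∘ toℕ))
    (cong₂ _+_ (sum-cong-≗ {n} {suc ∘ toℕ ∘ inject₁} {suc ∘ toℕ} (cong suc ∘ toℕ-inject₁))
               (cong suc (toℕ-fromℕ n)))

restrict : ∀ {A : Set} {P : Pred A 0ℓ} → Decidable P → (A → ℕ) → A → ℕ
restrict P? f y with P? y
... | yes _ = f y
... | no  _ = 0

restrict-yes : ∀ {A : Set} {P : Pred A 0ℓ} (P? : Decidable P) (f : A → ℕ) {y} →
               P y → restrict P? f y ≡ f y
restrict-yes P? f {y} p with P? y
... | yes _  = refl
... | no ¬p = contradiction p ¬p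

restrict-no : ∀ {A : Set} {P : Pred A 0ℓ} (P? : Decidable P) (f : A → ℕ) {y} →
              ¬ P y → restrict P? f y ≡ 0
restrict-no P? f {y} ¬p with P? y
... | yes p = contradiction p ¬p
... | no _  = refl

sum-map-filter : ∀ {A : Set} {P : Pred A 0ℓ} (P? : Decidable P) (f : A → ℕ) xs →
                 List.sum (map f (filter P? xs)) ≡ List.sum (map (restrict P? f) xs)
sum-map-filter P? f []       = refl
sum-map-filter P? f (y ∷ ys) with P? y
... | yes _ = cong (f y +_) (sum-map-filter P? f ys)
... | no  _ = sum-map-filter P? f ys

sum-tabulate : ∀ {n} (f : Fin n → ℕ) → List.sum (tabulate f) ≡ sum f
sum-tabulate {zero}  f = refl
sum-tabulate {suc n} f = cong (f zero +_) (sum-tabulate (f ∘ suc))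

sum-map-filter-allFin : ∀ {n} {P : Pred (Fin n) 0ℓ} (P? : Decidable P) (f : Fin n → ℕ) →
                        List.sum (map f (filter P? (allFin n))) ≡ sum (restrict P? f)
sum-map-filter-allFin {n} P? f = begin
  List.sum (map f (filter P? (allFin n)))   ≡⟨ sum-map-filter P? f (allFin n) ⟩
  List.sum (map (restrict P? f) (allFin n)) ≡⟨ cong List.sum (map-tabulate id (restrict P? f)) ⟩
  List.sum (tabulate (restrict P? f))       ≡⟨ sum-tabulate (restrict P? f) ⟩
  sum (restrict P? f)                       ∎
  where open ≡-Reasoning

-- Closed neighbourhoods in c K_n

module _ {c n : ℕ} where

  copyOf : Fin (c * n) → Fin c
  copyOf = quotient n

  inCopy? : ∀ q → Decidable (λ y → copyOf y ≡ q)
  inCopy? q y = copyOf y ≟ᶠ q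

  copyOf-combine : ∀ q k → copyOf (combine q k) ≡ q
  copyOf-combine q k = cong proj₁ (remQuot-combine q k)

  ∑-restrict-copy : ∀ (f : Fin (c * n) → ℕ) q →
                    sum (restrict (inCopy? q) f) ≡ ∑[ k < n ] f (combine q k)
  ∑-restrict-copy f q = begin
    sum (restrict (inCopy? q) f)
      ≡⟨ ∑-combine c n (restrict (inCopy? q) f) ⟩
    ∑[ q′ < c ] ∑[ k < n ] restrict (inCopy? q) f (combine q′ k)
      ≡⟨ ∑-single _ q (λ q′ q′≢q → ∑-zero _ λ k →
           restrict-no (inCopy? q) f (q′≢q ∘ trans (sym (copyOf-combine q′ k)))) ⟩
    ∑[ k < n ] restrict (inCopy? q) f (combine q k)
      ≡⟨ sum-cong-≗ (λ k → restrict-yes (inCopy? q) f (copyOf-combine q k)) ⟩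
    ∑[ k < n ] f (combine q k) ∎
    where open ≡-Reasoning

  closedNbhd-cK-sum : ∀ (f : Fin (c * n) → ℕ) x →
                      List.sum (map f (closedNbhd (cK c n) x)) ≡ ∑[ k < n ] f (combine (copyOf x) k)
  closedNbhd-cK-sum f x = begin
    List.sum (map f (self ++ nbrs))
      ≡⟨ cong List.sum (map-++ f self nbrs) ⟩
    List.sum (map f self ++ map f nbrs)
      ≡⟨ sum-++ (map f self) (map f nbrs) ⟩
    List.sum (map f self) + List.sum (map f nbrs)
      ≡⟨ cong₂ _+_ (sum-map-filter-allFin (_≟ᶠ x) f) (sum-map-filter-allFin (adj? G x) f) ⟩
    sum (restrict (_≟ᶠ x) f) + sum (restrict (adj? G x) f)
      ≡⟨ ∑-distrib-+ (restrict (_≟ᶠ x) f) (restrict (adj? G x) f) ⟨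
    ∑[ y < c * n ] (restrict (_≟ᶠ x) f y + restrict (adj? G x) f y)
      ≡⟨ sum-cong-≗ self-or-nbr≡same-copy ⟩
    sum (restrict (inCopy? (copyOf x)) f)
      ≡⟨ ∑-restrict-copy f (copyOf x) ⟩
    ∑[ k < n ] f (combine (copyOf x) k) ∎
    where
    open ≡-Reasoning
    G = cK c n
    self nbrs : List (Fin (c * n))
    self = filter (_≟ᶠ x) (allFin (c * n))
    nbrs = filter (adj? G x) (allFin (c * n))

    self-or-nbr≡same-copy : ∀ y → restrict (_≟ᶠ x) f y + restrict (adj? G x) f y
                                ≡ restrict (inCopy? (copyOf x)) f y
    self-or-nbr≡same-copy y with y ≟ᶠ x
    ... | yes refl = begin
      f y + restrict (adj? G x) f y    ≡⟨ cong (f y +_) (restrict-no (adj? G x) f (irrefl G)) ⟩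
      f y + 0                          ≡⟨ +-comm (f y) 0 ⟩
      f y                              ≡⟨ restrict-yes (inCopy? (copyOf x)) f refl ⟨
      restrict (inCopy? (copyOf x)) f y ∎
    ... | no y≢x with copyOf y ≟ᶠ copyOf x
    ...   | yes same  = restrict-yes (adj? G x) f (sym same , y≢x ∘ sym)
    ...   | no  other = restrict-no (adj? G x) f (other ∘ sym ∘ proj₁)

-- Necessity

data EvenOrOdd : ℕ → Set where
  even : ∀ t → EvenOrOdd (2 * t)
  odd  : ∀ t → EvenOrOdd (suc (2 * t))

evenOrOdd : ∀ n → EvenOrOdd n
evenOrOdd zero = even 0
evenOrOdd (suc n) with evenOrOdd n
... | even t = odd t
... | odd  t = subst EvenOrOdd (*-suc 2 t) (even (suc t))

≡*2⇒%2≡0 : ∀ {a} b → a ≡ b * 2 → a % 2 ≡ 0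
≡*2⇒%2≡0 b refl = m*n%n≡0 b 2

≡1+*2⇒%2≡1 : ∀ {a} b → a ≡ 1 + b * 2 → a % 2 ≡ 1
≡1+*2⇒%2≡1 b refl = [m+kn]%n≡m%n 1 b 2

n[1+cn]-even⇒n[c+1]-even : ∀ n c k → 2 * k ≡ n * suc (c * n) → (n * (c + 1)) % 2 ≡ 0
n[1+cn]-even⇒n[c+1]-even n c k 2k≡ with evenOrOdd n | evenOrOdd c
... | even t | _      = ≡*2⇒%2≡0 (t * (c + 1)) (even-n t c)
  where
  even-n : ∀ t c → 2 * t * (c + 1) ≡ t * (c + 1) * 2
  even-n = solve-∀
... | odd t  | odd u  = ≡*2⇒%2≡0 (suc (2 * t) * suc u) (odd-c t u)
  where
  odd-c : ∀ t u → suc (2 * t) * (suc (2 * u) + 1) ≡ suc (2 * t) * suc u * 2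
  odd-c = solve-∀
... | odd t  | even u =
  contradiction (trans 2k≡ (odd-n-even-c t u)) (even≢odd k (t + u * suc (2 * t) * suc (2 * t)))
  where
  odd-n-even-c : ∀ t u → suc (2 * t) * suc (2 * u * suc (2 * t))
                         ≡ suc (2 * (t + u * suc (2 * t) * suc (2 * t)))
  odd-n-even-c = solve-∀

module _ {c n : ℕ} (magic : ClosedDistanceMagic (cK c (suc n))) where

  magicConstant : ℕ
  magicConstant = proj₁ (proj₂ magic)

  private
    ℓ = Bijection.to (proj₁ magic)
    k′ = magicConstant

    L : Fin (c * suc n) → ℕ
    L = suc ∘ toℕ ∘ ℓ

  copySum≡magicConstant : ∀ q → ∑[ k < suc n ] L (combine q k) ≡ k′
  copySum≡magicConstant q = begin
    ∑[ k < suc n ] L (combine q k)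
      ≡⟨ cong (λ q′ → ∑[ k < suc n ] L (combine q′ k)) (copyOf-combine {c} {suc n} q zero) ⟨
    ∑[ k < suc n ] L (combine (copyOf {c} x) k) ≡⟨ closedNbhd-cK-sum {c} L x ⟨
    labelSum (cK c (suc n)) ℓ x                 ≡⟨ proj₂ (proj₂ (proj₂ magic)) x ⟩
    k′                                          ∎
    where
    open ≡-Reasoning
    x = combine {c} {suc n} q zero

  c*magicConstant≡∑labels : c * k′ ≡ ∑[ i < c * suc n ] suc (toℕ i)
  c*magicConstant≡∑labels = begin
    c * k′                                    ≡⟨ ∑-const c k′ ⟨
    ∑[ q < c ] k′                             ≡⟨ sum-cong-≗ {c} copySum≡magicConstant ⟨
    ∑[ q < c ] ∑[ k < suc n ] L (combine q k) ≡⟨ ∑-combine c (suc n) L ⟨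
    sum L                                     ≡⟨ ∑-permute (suc ∘ toℕ) (Bijection⇒Inverse (proj₁ magic)) ⟨
    ∑[ i < c * suc n ] suc (toℕ i)            ∎
    where open ≡-Reasoning

  double-magicConstant : .{{_ : NonZero c}} → 2 * k′ ≡ suc n * suc (c * suc n)
  double-magicConstant = *-cancelˡ-≡ (2 * k′) (suc n * suc (c * suc n)) c (begin
    c * (2 * k′)                       ≡⟨ *-assoc c 2 k′ ⟨
    c * 2 * k′                         ≡⟨ cong (_* k′) (*-comm c 2) ⟩
    2 * c * k′                         ≡⟨ *-assoc 2 c k′ ⟩
    2 * (c * k′)                       ≡⟨ cong (2 *_) c*magicConstant≡∑labels ⟩
    2 * ∑[ i < c * suc n ] suc (toℕ i) ≡⟨ double-∑-suc-toℕ (c * suc n) ⟩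
    c * suc n * suc (c * suc n)        ≡⟨ *-assoc c (suc n) (suc (c * suc n)) ⟩
    c * (suc n * suc (c * suc n))      ∎)
    where open ≡-Reasoning

-- Kotzig arrays

record Permutes (c : ℕ) (f : ℕ → ℕ) : Set where
  field
    bounded   : ∀ {q} → q < c → f q < c
    injective : ∀ {q q′} → q < c → q′ < c → f q ≡ f q′ → q ≡ q′

record KotzigArray (n c : ℕ) : Set where
  field
    row          : Fin n → ℕ → ℕ
    row-permutes : ∀ k → Permutes c (row k)
    columnSum    : ℕ
    column-sum   : ∀ {q} → q < c → ∑[ k < n ] row k q ≡ columnSum

noRows : ∀ {c} → KotzigArray 0 c
noRows = record { row = λ () ; row-permutes = λ () ; columnSum = 0 ; column-sum = λ _ → refl }

stack : ∀ {n n′ c} → KotzigArray n c → KotzigArray n′ c → KotzigArray (n + n′) c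
stack {n} {n′} {c} A B = record
  { row          = A.row ++ᵛ B.row
  ; row-permutes = stacked-permutes
  ; columnSum    = A.columnSum + B.columnSum
  ; column-sum   = stacked-sum
  }
  where
  module A = KotzigArray A
  module B = KotzigArray B

  stacked-permutes : ∀ k → Permutes c ((A.row ++ᵛ B.row) k)
  stacked-permutes k with splitAt n k
  ... | inj₁ i = A.row-permutes i
  ... | inj₂ j = B.row-permutes j

  stacked-sum : ∀ {q} → q < c → ∑[ k < n + n′ ] (A.row ++ᵛ B.row) k q ≡ A.columnSum + B.columnSum
  stacked-sum {q} q<c = begin
    ∑[ k < n + n′ ] (A.row ++ᵛ B.row) k q
      ≡⟨ ∑-↑ˡ-↑ʳ n n′ (λ k → (A.row ++ᵛ B.row) k q) ⟩
    ∑[ i < n ] (A.row ++ᵛ B.row) (i ↑ˡ n′) q + ∑[ j < n′ ] (A.row ++ᵛ B.row) (n ↑ʳ j) q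
      ≡⟨ cong₂ _+_ (sum-cong-≗ {n} (λ i → cong-app (lookup-++ˡ A.row B.row i) q))
                   (sum-cong-≗ {n′} (λ j → cong-app (lookup-++ʳ A.row B.row j) q)) ⟩
    ∑[ i < n ] A.row i q + ∑[ j < n′ ] B.row j q
      ≡⟨ cong₂ _+_ (A.column-sum q<c) (B.column-sum q<c) ⟩
    A.columnSum + B.columnSum ∎
    where open ≡-Reasoning

id-permutes : ∀ c → Permutes c id
id-permutes c = record { bounded = id ; injective = λ _ _ → id }

reverse-permutes : ∀ c → Permutes c (λ q → c ∸ suc q)
reverse-permutes c = record
  { bounded   = λ {q} q<c → m+n≤o⇒m≤o (suc (c ∸ suc q))
                  (≤-reflexive (trans (cong suc (+-comm (c ∸ suc q) q)) (m+[n∸m]≡n q<c)))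
  ; injective = λ q<c q′<c eq → suc-injective (∸-cancelˡ-≡ q<c q′<c eq)
  }

identityReverseRows : ∀ c → KotzigArray 2 c
identityReverseRows c = record
  { row          = λ { zero → id ; (suc zero) q → c ∸ suc q }
  ; row-permutes = λ { zero → id-permutes c ; (suc zero) → reverse-permutes c }
  ; columnSum    = pred c
  ; column-sum   = λ {q} q<c → trans (cong (q +_) (+-identityʳ (c ∸ suc q))) (cong pred (m+[n∸m]≡n q<c))
  }

evenKotzigArray : ∀ m c → KotzigArray (2 * m) c
evenKotzigArray zero    c = noRows
evenKotzigArray (suc m) c =
  subst (λ n → KotzigArray n c) (sym (*-suc 2 m)) (stack (identityReverseRows c) (evenKotzigArray m c))

-- On {0,…,2s}: shift s q = q + s and twist s q = 2(s − q), both mod 2s+1.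
shift twist : ℕ → ℕ → ℕ
shift s q with q ≤? s
... | yes _ = q + s
... | no  _ = q ∸ suc s
twist s q with q ≤? s
... | yes _ = 2 * (s ∸ q)
... | no  _ = suc (2 * (2 * s ∸ q))

shift-lower : ∀ {s q e} → q + e ≡ s → shift s q ≡ q + s
shift-lower {s} {q} q+e≡s with q ≤? s
... | yes _   = refl
... | no  q≰s = contradiction (m+n≤o⇒m≤o q (≤-reflexive q+e≡s)) q≰s

shift-upper : ∀ {s q u} → suc s + u ≡ q → shift s q ≡ u
shift-upper {s} {u = u} refl with suc s + u ≤? s
... | yes 1+s+u≤s = contradiction (m+n≤o⇒m≤o (suc s) 1+s+u≤s) 1+n≰n
... | no  _       = m+n∸m≡n (suc s) u

twist-lower : ∀ {s q e} → q + e ≡ s → twist s q ≡ 2 * e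
twist-lower {q = q} {e} refl with q ≤? q + e
... | yes _   = cong (2 *_) (m+n∸m≡n q e)
... | no  q≰s = contradiction (m≤m+n q e) q≰s

twist-upper : ∀ {s q u d} → suc s + u ≡ q → suc u + d ≡ s → twist s q ≡ suc (2 * d)
twist-upper {q = q} {u} {d} refl refl with q ≤? suc u + d
... | yes q≤s = contradiction (m+n≤o⇒m≤o (suc (suc u + d)) q≤s) 1+n≰n
... | no  _   = cong (λ x → suc (2 * x)) (trans (cong (_∸ q) (2s≡q+d u d)) (m+n∸m≡n q d))
  where
  2s≡q+d : ∀ u d → 2 * (suc u + d) ≡ suc (suc u + d) + u + d
  2s≡q+d = solve-∀

data Half (s q : ℕ) : Set where
  lower : ∀ e → q + e ≡ s → shift s q ≡ q + s → twist s q ≡ 2 * e → Half s q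
  upper : ∀ u d → suc s + u ≡ q → suc u + d ≡ s → shift s q ≡ u → twist s q ≡ suc (2 * d) → Half s q

half : ∀ {s q} → q < suc (2 * s) → Half s q
half {s} {q} q<1+2s with q ≤? s
... | yes q≤s = lower e q+e≡s (shift-lower {s} {q} {e} q+e≡s) (twist-lower {s} {q} {e} q+e≡s)
  where
  e = s ∸ q
  q+e≡s = m+[n∸m]≡n q≤s
... | no  q≰s = upper u d 1+s+u≡q 1+u+d≡s
                  (shift-upper {s} {q} {u} 1+s+u≡q) (twist-upper {s} {q} {u} {d} 1+s+u≡q 1+u+d≡s)
  where
  u = q ∸ suc s
  1+s+u≡q = m+[n∸m]≡n (≰⇒> q≰s)
  u<s : u < s
  u<s = +-cancelˡ-≤ s (suc u) s (begin
    s + suc u ≡⟨ +-suc s u ⟩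
    suc s + u ≡⟨ 1+s+u≡q ⟩
    q         ≤⟨ s≤s⁻¹ q<1+2s ⟩
    2 * s     ≡⟨ cong (s +_) (+-identityʳ s) ⟩
    s + s     ∎)
    where open ≤-Reasoning
  d = s ∸ suc u
  1+u+d≡s = m+[n∸m]≡n u<s

shift-bounded : ∀ {s q} → q < suc (2 * s) → shift s q < suc (2 * s)
shift-bounded {s} {q} q<c with half {s} q<c
... | lower e refl shift≡ _ rewrite shift≡ =
  s≤s (m+n≤o⇒m≤o (q + (q + e)) (≤-reflexive (lower-fits q e)))
  where
  lower-fits : ∀ q e → q + (q + e) + e ≡ 2 * (q + e)
  lower-fits = solve-∀
... | upper u d refl refl shift≡ _ rewrite shift≡ =
  s≤s (m+n≤o⇒m≤o u (≤-reflexive (upper-fits u d)))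
  where
  upper-fits : ∀ u d → u + (u + 2 * d + 2) ≡ 2 * (suc u + d)
  upper-fits = solve-∀

twist-bounded : ∀ {s q} → q < suc (2 * s) → twist s q < suc (2 * s)
twist-bounded {s} {q} q<c with half {s} q<c
... | lower e refl _ twist≡ rewrite twist≡ =
  s≤s (m+n≤o⇒m≤o (2 * e) (≤-reflexive (lower-fits q e)))
  where
  lower-fits : ∀ q e → 2 * e + 2 * q ≡ 2 * (q + e)
  lower-fits = solve-∀
... | upper u d refl refl _ twist≡ rewrite twist≡ =
  s≤s (m+n≤o⇒m≤o (suc (2 * d)) (≤-reflexive (upper-fits u d)))
  where
  upper-fits : ∀ u d → suc (2 * d) + suc (2 * u) ≡ 2 * (suc u + d)
  upper-fits = solve-∀

upper-shift≢lower-shift : ∀ {s u d} q → suc u + d ≡ s → u ≢ q + s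
upper-shift≢lower-shift {s} {u} q 1+u+d≡s u≡q+s =
  1+n≰n (≤-trans (m+n≤o⇒m≤o (suc u) (≤-reflexive 1+u+d≡s)) (subst (s ≤_) (sym u≡q+s) (m≤n+m s q)))

shift-injective : ∀ {s q q′} → q < suc (2 * s) → q′ < suc (2 * s) →
                  shift s q ≡ shift s q′ → q ≡ q′
shift-injective {s} {q} {q′} q<c q′<c eq with half {s} q<c | half {s} q′<c
... | lower _ _ shift≡ _ | lower _ _ shift≡′ _ =
  +-cancelʳ-≡ s q q′ (trans (sym shift≡) (trans eq shift≡′))
... | upper _ _ p _ shift≡ _ | upper _ _ p′ _ shift≡′ _ =
  trans (sym p) (trans (cong (suc s +_) (trans (sym shift≡) (trans eq shift≡′))) p′)
... | lower _ _ shift≡ _ | upper _ _ _ r′ shift≡′ _ =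
  contradiction (trans (sym shift≡′) (trans (sym eq) shift≡)) (upper-shift≢lower-shift q r′)
... | upper _ _ _ r shift≡ _ | lower _ _ shift≡′ _ =
  contradiction (trans (sym shift≡) (trans eq shift≡′)) (upper-shift≢lower-shift q′ r)

twist-injective : ∀ {s q q′} → q < suc (2 * s) → q′ < suc (2 * s) →
                  twist s q ≡ twist s q′ → q ≡ q′
twist-injective {s} {q} {q′} q<c q′<c eq with half {s} q<c | half {s} q′<c
... | lower e p _ twist≡ | lower e′ p′ _ twist≡′ =
  +-cancelʳ-≡ e q q′ (trans p (trans (sym p′) (cong (q′ +_) (sym e≡e′))))
  where
  e≡e′ = *-cancelˡ-≡ e e′ 2 (trans (sym twist≡) (trans eq twist≡′))
... | upper u d p r _ twist≡ | upper u′ d′ p′ r′ _ twist≡′ =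
  trans (sym p) (trans (cong (suc s +_) u≡u′) p′)
  where
  d≡d′ = *-cancelˡ-≡ d d′ 2 (suc-injective (trans (sym twist≡) (trans eq twist≡′)))
  u≡u′ = suc-injective (+-cancelʳ-≡ d (suc u) (suc u′)
           (trans r (trans (sym r′) (cong (suc u′ +_) (sym d≡d′)))))
... | lower e _ _ twist≡ | upper _ d′ _ _ _ twist≡′ =
  contradiction (trans (sym twist≡) (trans eq twist≡′)) (even≢odd e d′)
... | upper _ d _ _ _ twist≡ | lower e′ _ _ twist≡′ =
  contradiction (trans (sym twist≡′) (trans (sym eq) twist≡)) (even≢odd e′ d)

id+shift+twist≡3s : ∀ {s q} → q < suc (2 * s) → q + (shift s q + (twist s q + 0)) ≡ 3 * s
id+shift+twist≡3s {s} {q} q<c with half {s} q<c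
... | lower e refl shift≡ twist≡ rewrite shift≡ | twist≡ = lower-sum q e
  where
  lower-sum : ∀ q e → q + (q + (q + e) + (2 * e + 0)) ≡ 3 * (q + e)
  lower-sum = solve-∀
... | upper u d refl refl shift≡ twist≡ rewrite shift≡ | twist≡ = upper-sum u d
  where
  upper-sum : ∀ u d → suc (suc u + d) + u + (u + (suc (2 * d) + 0)) ≡ 3 * (suc u + d)
  upper-sum = solve-∀

identityShiftTwistRows : ∀ s → KotzigArray 3 (suc (2 * s))
identityShiftTwistRows s = record
  { row          = λ { zero → id ; (suc zero) → shift s ; (suc (suc zero)) → twist s }
  ; row-permutes = λ { zero             → id-permutes _
                     ; (suc zero)       → record { bounded = shift-bounded ; injective = shift-injective }
                     ; (suc (suc zero)) → record { bounded = twist-bounded ; injective = twist-injective } }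
  ; columnSum    = 3 * s
  ; column-sum   = id+shift+twist≡3s
  }

kotzigArray-exists : ∀ n c → 2 ≤ n → (n * (c + 1)) % 2 ≡ 0 → KotzigArray n c
kotzigArray-exists n c 2≤n n[c+1]-even with evenOrOdd n
... | even t   = evenKotzigArray t c
... | odd zero = contradiction 2≤n λ { (s≤s ()) }
... | odd (suc m) with evenOrOdd c
...   | odd s  = subst (λ n → KotzigArray n c) (cong suc (sym (*-suc 2 m)))
                   (stack (identityShiftTwistRows s) (evenKotzigArray m c))
...   | even s = contradiction
                   (trans (sym n[c+1]-even) (≡1+*2⇒%2≡1 (suc m + s * suc (2 * suc m)) (odd-n-even-c m s)))
                   λ ()
  where
  odd-n-even-c : ∀ m s → suc (2 * suc m) * (2 * s + 1) ≡ 1 + (suc m + s * suc (2 * suc m)) * 2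
  odd-n-even-c = solve-∀

-- The labelling of c K_n given by a Kotzig array

injective⇒strictlySurjective : ∀ {n} {f : Fin n → Fin n} →
                               Injective _≡_ _≡_ f → StrictlySurjective _≡_ f
injective⇒strictlySurjective {suc n} {f} f-injective y with any? (λ x → f x ≟ᶠ y)
... | yes hit  = hit
... | no  miss = contradiction (injective⇒≤ punched-injective) 1+n≰n
  where
  y≢f : ∀ x → y ≢ f x
  y≢f x = miss ∘ (x ,_) ∘ sym

  punched : Fin (suc n) → Fin n
  punched x = punchOut (y≢f x)

  punched-injective : Injective _≡_ _≡_ punched
  punched-injective {x} {x′} = f-injective ∘ punchOut-injective (y≢f x) (y≢f x′)

module KotzigLabelling {n c} (A : KotzigArray n c) where
  open KotzigArray A

  entry : Fin n → Fin c → Fin c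
  entry k q = fromℕ< (Permutes.bounded (row-permutes k) (toℕ<n q))

  relabel : Fin c × Fin n → Fin (c * n)
  relabel (q , k) = combine (entry k q) k

  label : Fin (c * n) → Fin (c * n)
  label = relabel ∘ remQuot {c} n

  entry-injective : ∀ k {q q′} → entry k q ≡ entry k q′ → q ≡ q′
  entry-injective k {q} {q′} eq = toℕ-injective (Permutes.injective (row-permutes k) (toℕ<n q) (toℕ<n q′)
    (trans (sym (toℕ-fromℕ< _)) (trans (cong toℕ eq) (toℕ-fromℕ< _))))

  relabel-injective : Injective _≡_ _≡_ relabel
  relabel-injective {q , k} {q′ , k′} eq with combine-injective (entry k q) k (entry k′ q′) k′ eq
  ... | entries≡ , refl = cong (_, k) (entry-injective k entries≡)

  label-injective : Injective _≡_ _≡_ label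
  label-injective {x} {y} eq = begin
    x                                  ≡⟨ combine-remQuot {c} n x ⟨
    uncurry combine (remQuot {c} n x)  ≡⟨ cong (uncurry combine) (relabel-injective eq) ⟩
    uncurry combine (remQuot {c} n y)  ≡⟨ combine-remQuot {c} n y ⟩
    y                                  ∎
    where open ≡-Reasoning

  label-bijection : Fin (c * n) ⤖ Fin (c * n)
  label-bijection =
    mk⤖ (label-injective , strictlySurjective⇒surjective (injective⇒strictlySurjective label-injective))

  copySum-label : ∀ q → ∑[ k < n ] suc (toℕ (label (combine q k)))
                        ≡ ∑[ k < n ] suc (toℕ k) + n * columnSum
  copySum-label q = begin
    ∑[ k < n ] suc (toℕ (label (combine q k)))
      ≡⟨ sum-cong-≗ {n} label-combine ⟩
    ∑[ k < n ] (suc (toℕ k) + n * row k (toℕ q))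
      ≡⟨ ∑-distrib-+ (suc ∘ toℕ) (λ k → n * row k (toℕ q)) ⟩
    ∑[ k < n ] suc (toℕ k) + ∑[ k < n ] (n * row k (toℕ q))
      ≡⟨ cong (λ t → ∑[ k < n ] suc (toℕ k) + t) (*-distribˡ-sum n (λ k → row k (toℕ q))) ⟨
    ∑[ k < n ] suc (toℕ k) + n * ∑[ k < n ] row k (toℕ q)
      ≡⟨ cong (λ t → ∑[ k < n ] suc (toℕ k) + n * t) (column-sum (toℕ<n q)) ⟩
    ∑[ k < n ] suc (toℕ k) + n * columnSum ∎
    where
    open ≡-Reasoning
    label-combine : ∀ k → suc (toℕ (label (combine q k))) ≡ suc (toℕ k) + n * row k (toℕ q)
    label-combine k = cong suc (begin
      toℕ (label (combine q k))    ≡⟨ cong (toℕ ∘ relabel) (remQuot-combine q k) ⟩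
      toℕ (combine (entry k q) k)  ≡⟨ toℕ-combine (entry k q) k ⟩
      n * toℕ (entry k q) + toℕ k  ≡⟨ cong (λ t → n * t + toℕ k) (toℕ-fromℕ< _) ⟩
      n * row k (toℕ q) + toℕ k    ≡⟨ +-comm (n * row k (toℕ q)) (toℕ k) ⟩
      toℕ k + n * row k (toℕ q)    ∎)

kotzigArray⇒closedDistanceMagic : ∀ {n c} → KotzigArray (suc n) c → ClosedDistanceMagic (cK c (suc n))
kotzigArray⇒closedDistanceMagic {n} {c} A =
  -- the constant is positive by computation: its k = 0 summand is a successor
  label-bijection , _ , s≤s z≤n ,
  λ x → trans (closedNbhd-cK-sum {c} (suc ∘ toℕ ∘ label) x) (copySum-label (copyOf x))
  where open KotzigLabelling A

mainTheorem13 : (n c : ℕ) → 2 ≤ n → 1 ≤ c →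
    (ClosedDistanceMagic (cK c n) ⇔ ((n * (c + 1)) % 2 ≡ 0))
mainTheorem13 zero    _       ()  _
mainTheorem13 (suc n) zero    _   ()
mainTheorem13 (suc n) (suc c) 2≤n _ = mk⇔
  (λ magic → n[1+cn]-even⇒n[c+1]-even (suc n) (suc c) (magicConstant magic) (double-magicConstant magic))
  (kotzigArray⇒closedDistanceMagic ∘ kotzigArray-exists (suc n) (suc c) 2≤n)
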